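{- With respect to any valid colouring using exactly two colours: (i) for $d\in\mathbb{N}$ the hypercube $Q_d$ is strictly $2^{d-1}$-local; (ii) every connected knight's graph $KG=(V_1\,\dot\cup\,V_2,E)$ and every gear graph $G_d=(V_1\,\dot\cup\,V_2,E)$, where $V_1,V_2$ are the two colour classes, is strictly $\min\{|V_1|,|V_2|\}$-local; (iii) for $d\ge 3$ the $d$-crown graph $(\{x_1,\dots,x_d,y_1,\dots,y_d\},\{\{x_i,y_j\}\mid i,j\in[d],\,i\ne j\})$ is strictly $d$-local.
   Context: $Q_d$ is the graph of vertices and edges of the $d$-dimensional hypercube. For $d_1,d_2\in\mathbb{N}$ the $d_1\times d_2$ knight's graph has a vertex for each square of a $d_1\times d_2$ chessboard and an edge for each legal knight move. The gear graph $G_d$ is the wheel graph $W_d$ (a vertex joined to all vertices of a cycle on $d-1$ vertices) with a new vertex inserted between each pair of adjacent vertices of the outer cycle. A colouring of $G=(V,E)$ is a function $c:V\to[\ell]$; valid means adjacent vertices get distinct colours. Let $\mathcal C(G,c)=c(V)$, $m=|\mathcal C(G,c)|$; a marking sequence is an enumeration $e=(x_1,\dots,x_m)$ of $\mathcal C(G,c)$; $G_i$ is the subgraph induced by the vertices with colours in $\{x_1,\dots,x_i\}$; with $\gamma(H)$ the number of connected components, $\operatorname{loc}(G,c,e)=\max_i\gamma(G_i)$, $\operatorname{loc}(G,c)=\min_e\operatorname{loc}(G,c,e)$. $G$ is strictly $k$-local if $\operatorname{loc}(G,c)=k$. -}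

module Defs where

open import Data.Nat using (ℕ; zero; suc; _+_; _∸_; _≤_; ∣_-_∣; _⊓_)
open import Data.Fin as Fin using (Fin; toℕ)
open import Data.Fin.Properties using () renaming (_≟_ to _≟F_)
open import Data.Bool using (Bool; true; false; if_then_else_; _xor_)
open import Data.Vec using (Vec; []; _∷_)
open import Data.List using (List; []; _∷_; take; length; filter; map; _++_; cartesianProduct; allFin)
open import Data.List.Membership.Propositional using (_∈_)
open import Data.List.Relation.Unary.Unique.Propositional using (Unique)
open import Data.Product using (Σ; ∃; _×_; _,_)
open import Data.Sum using (_⊎_)
open import Data.Unit using (⊤)
open import Relation.Binary.PropositionalEquality using (_≡_; _≢_)

-- Graphs (undirected; an edge u–v is witnessed by E u v or E v u)

record Graph : Set₁ where
  constructor graph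
  field
    V : Set
    E : V → V → Set

module _ (G : Graph) where
  open Graph G

  data Reach (S : V → Set) : V → V → Set where
    here : ∀ {u} → S u → Reach S u u
    step : ∀ {u w v} → Reach S u w → (E w v ⊎ E v w) → S v → Reach S u v

  Connected : Set
  Connected = ∀ u v → Reach (λ _ → ⊤) u v

  -- γ(G[S]) = k : the induced subgraph on S has exactly k connected
  -- components, i.e. there is a surjective labelling of the vertices of S
  -- by Fin k whose fibres are exactly the components.
  HasComponents : (V → Set) → ℕ → Set
  HasComponents S k =
    Σ ((v : V) → S v → Fin k) λ f →
      (∀ j → ∃ λ v → Σ (S v) λ s → f v s ≡ j) ×
      (∀ u v (su : S u) (sv : S v) →
         (f u su ≡ f v sv → Reach S u v) × (Reach S u v → f u su ≡ f v sv))

  Valid : ∀ {ℓ} → (V → Fin ℓ) → Set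
  Valid c = ∀ u v → E u v → c u ≢ c v

  MarkingSequence : ∀ {ℓ} → (V → Fin ℓ) → List (Fin ℓ) → Set
  MarkingSequence c e =
    Unique e × (∀ x → (x ∈ e → ∃ λ v → c v ≡ x) × ((∃ λ v → c v ≡ x) → x ∈ e))

  Layer : ∀ {ℓ} → (V → Fin ℓ) → List (Fin ℓ) → ℕ → V → Set
  Layer c e i v = c v ∈ take i e

  LocSeq : ∀ {ℓ} → (V → Fin ℓ) → List (Fin ℓ) → ℕ → Set
  LocSeq c e k =
    (∃ λ i → 1 ≤ i × i ≤ length e × HasComponents (Layer c e i) k) ×
    (∀ i → 1 ≤ i → i ≤ length e → ∃ λ g → HasComponents (Layer c e i) g × g ≤ k)

  StrictlyLocal : ∀ {ℓ} → (V → Fin ℓ) → ℕ → Set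
  StrictlyLocal c k =
    (∃ λ e → MarkingSequence c e × LocSeq c e k) ×
    (∀ e → MarkingSequence c e → ∃ λ k' → LocSeq c e k' × k ≤ k')

  ExactlyTwoColours : ∀ {ℓ} → (V → Fin ℓ) → Fin ℓ → Fin ℓ → Set
  ExactlyTwoColours c a b =
    a ≢ b × (∀ v → c v ≡ a ⊎ c v ≡ b) × (∃ λ v → c v ≡ a) × (∃ λ v → c v ≡ b)

countColour : ∀ {V : Set} {ℓ} → List V → (V → Fin ℓ) → Fin ℓ → ℕ
countColour vs c a = length (filter (λ v → c v ≟F a) vs)

hamming : ∀ {d} → Vec Bool d → Vec Bool d → ℕ
hamming []       []       = 0
hamming (x ∷ xs) (y ∷ ys) = (if x xor y then 1 else 0) + hamming xs ys

Q : ℕ → Graph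
Q d = graph (Vec Bool d) (λ u v → hamming u v ≡ 1)

KnightV : ℕ → ℕ → Set
KnightV d₁ d₂ = Fin d₁ × Fin d₂

knightMove : ∀ {d₁ d₂} → KnightV d₁ d₂ → KnightV d₁ d₂ → Set
knightMove (r , s) (r' , s') =
  (∣ toℕ r - toℕ r' ∣ ≡ 1 × ∣ toℕ s - toℕ s' ∣ ≡ 2) ⊎
  (∣ toℕ r - toℕ r' ∣ ≡ 2 × ∣ toℕ s - toℕ s' ∣ ≡ 1)

Knight : ℕ → ℕ → Graph
Knight d₁ d₂ = graph (KnightV d₁ d₂) knightMove

knightVertices : ∀ d₁ d₂ → List (KnightV d₁ d₂)
knightVertices d₁ d₂ = cartesianProduct (allFin d₁) (allFin d₂)

-- Gear graph G_d : wheel W_d (hub + cycle rim₀ … rim_{m-1}, m = d-1)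
-- with a new vertex mid_i inserted between rim_i and rim_{i+1 mod m}

data GearV (m : ℕ) : Set where
  hub : GearV m
  rim : Fin m → GearV m
  mid : Fin m → GearV m

IsNext : ∀ {m} → Fin m → Fin m → Set
IsNext {m} i j = suc (toℕ i) ≡ toℕ j ⊎ (suc (toℕ i) ≡ m × toℕ j ≡ 0)

data GearE {m : ℕ} : GearV m → GearV m → Set where
  hub-rim  : ∀ i → GearE hub (rim i)
  rim-hub  : ∀ i → GearE (rim i) hub
  rim-mid  : ∀ i → GearE (rim i) (mid i)
  mid-rim  : ∀ i → GearE (mid i) (rim i)
  mid-next : ∀ i j → IsNext i j → GearE (mid i) (rim j)
  next-mid : ∀ i j → IsNext i j → GearE (rim j) (mid i)

Gear : ℕ → Graph
Gear d = graph (GearV (d ∸ 1)) GearE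

gearVertices : ∀ d → List (GearV (d ∸ 1))
gearVertices d = hub ∷ (map rim (allFin (d ∸ 1)) ++ map mid (allFin (d ∸ 1)))

-- d-crown graph: vertices x_i = (false , i), y_i = (true , i);
-- x_i – y_j whenever i ≢ j

data CrownE {d : ℕ} : Bool × Fin d → Bool × Fin d → Set where
  xy : ∀ i j → i ≢ j → CrownE (false , i) (true , j)
  yx : ∀ i j → i ≢ j → CrownE (true , j) (false , i)

Crown : ℕ → Graph
Crown d = graph (Bool × Fin d) CrownE

module Submission where

-- A valid colouring by exactly two colours a and b admits only the marking sequences
-- (a, b) and (b, a). The first layer of (x, y) is the colour class of x, an independent
-- set, so it has one component per vertex; the second layer is the whole graph, which is
-- connected. Hence loc(G, c) = min(|c⁻¹(a)|, |c⁻¹(b)|). In a connected graph a proper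
-- 2-colouring is unique up to swapping the colours, so for Q_d and for the crown graph the
-- colour classes are the parity classes (2^(d-1) vertices each) and the two sides
-- {x_i}, {y_i} (d vertices each).

open import Defs
open import Axiom.UniquenessOfIdentityProofs.WithK using (uip)
open import Data.Bool using (Bool; true; false; _xor_)
open import Data.Bool.Properties using (¬-not; not-¬; not-injective; xor-assoc; xor-same; xor-identityʳ)
open import Data.Empty using (⊥-elim)
open import Data.Fin using (Fin; zero; suc; punchIn; punchOut)
open import Data.Fin.Properties
  using (toℕ<n; _≟_; 2↔Bool; punchInᵢ≢i; punchIn-injective; punchIn-punchOut)
open import Data.List using (List; []; _∷_; [_]; length; lookup; filter; map; allFin)
open import Data.List.Membership.Propositional using (_∈_; _∉_)
open import Data.List.Relation.Unary.All using ([]; _∷_)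
import Data.List.Relation.Unary.All as All
import Data.List.Relation.Unary.All.Properties as All
open import Data.List.Relation.Unary.AllPairs using ([]; _∷_)
open import Data.List.Relation.Unary.Any using (here; there; index)
open import Data.List.Relation.Unary.Any.Properties using (singleton⁻; lookup-index)
open import Data.List.Membership.Propositional.Properties
  using (∈-lookup; ∈-filter⁺; ∈-filter⁻; ∈-allFin; ∈-cartesianProduct⁺; ∈-map⁺; ∈-map⁻;
         ∈-++⁺ˡ; ∈-++⁺ʳ)
open import Data.List.Membership.Propositional.Properties.WithK using (unique⇒irrelevant)
import Data.List.Relation.Unary.Unique.Propositional.Properties as Unique
open import Data.List.Relation.Unary.Unique.Propositional using (Unique)
open import Data.Nat using (ℕ; zero; suc; _+_; _≤_; _⊓_; _∸_; _^_; z≤n; s≤s; _≤?_)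
open import Data.Nat.Properties
  using (≤-<-trans; suc-injective; m≤n⇒m⊓n≡m; m≥n⇒m⊓n≡n; m⊓n≤m; m⊓n≤n; ≰⇒≥; ≤-refl; ⊓-idem)
open import Data.Product using (Σ; ∃; _×_; _,_; proj₁; proj₂)
open import Data.Sum using (_⊎_; inj₁; inj₂)
import Data.Sum as Sum
open import Data.Vec using (Vec; []; _∷_)
open import Data.Vec.Recursive using (lift↔; Fin[m^n]↔Fin[m]^n)
open import Data.Vec.Recursive.Properties using (↔Vec)
open import Data.Unit using (⊤; tt)
open import Relation.Nullary using (yes; no)
open import Relation.Unary using (Decidable)
open import Function using (_∘_)
open import Function.Bundles using (_↔_; _⇔_; mk↔ₛ′; mk⇔; Inverse; Equivalence; Injection)
open import Function.Properties.Inverse using (↔⇒↣; ↔-trans; ↔-sym)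
open import Relation.Binary.PropositionalEquality
  using (_≡_; _≢_; refl; sym; trans; cong; cong₂; subst; module ≡-Reasoning)

ColourClass : {V : Set} {ℓ : ℕ} → (V → Fin ℓ) → Fin ℓ → Set
ColourClass {V} c x = Σ V λ v → c v ≡ x

Σ-≡-irrelevant : {V B : Set} {h : V → B} {y : B} {s t : Σ V λ v → h v ≡ y} →
                 proj₁ s ≡ proj₁ t → s ≡ t
Σ-≡-irrelevant {s = v , p} {t = .v , q} refl = cong (v ,_) (uip p q)

Σ-≡-cong : {V A B : Set} {g : V → A} {h : V → B} {x : A} {y : B} →
           (∀ v → g v ≡ x ⇔ h v ≡ y) → (Σ V λ v → g v ≡ x) ↔ (Σ V λ v → h v ≡ y)
Σ-≡-cong g⇔h = mk↔ₛ′
  (λ (v , p) → v , Equivalence.to (g⇔h v) p)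
  (λ (v , q) → v , Equivalence.from (g⇔h v) q)
  (λ _ → Σ-≡-irrelevant refl) (λ _ → Σ-≡-irrelevant refl)

AtMostTwoValues : {V A : Set} → (V → A) → Set
AtMostTwoValues f = ∀ {u v w} → f u ≢ f w → f v ≢ f w → f u ≡ f v

bool-atMostTwoValues : {V : Set} (f : V → Bool) → AtMostTwoValues f
bool-atMostTwoValues f u≢w v≢w = trans (¬-not u≢w) (sym (¬-not v≢w))

other-value : {A : Set} {a b x y : A} → x ≡ a → y ≡ a ⊎ y ≡ b → x ≢ y → y ≡ b
other-value x≡a (inj₁ y≡a) x≢y = ⊥-elim (x≢y (trans x≡a (sym y≡a)))
other-value x≡a (inj₂ y≡b) x≢y = y≡b

module _ {A : Set} {a b : A} where

  ≡-of-two-values : {x y z : A} → x ≡ a ⊎ x ≡ b → y ≡ a ⊎ y ≡ b → z ≡ a ⊎ z ≡ b →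
                    x ≢ z → y ≢ z → x ≡ y
  ≡-of-two-values (inj₁ x≡a) (inj₁ y≡a) _          _   _   = trans x≡a (sym y≡a)
  ≡-of-two-values (inj₂ x≡b) (inj₂ y≡b) _          _   _   = trans x≡b (sym y≡b)
  ≡-of-two-values (inj₁ x≡a) (inj₂ _)   (inj₁ z≡a) x≢z _   = ⊥-elim (x≢z (trans x≡a (sym z≡a)))
  ≡-of-two-values (inj₁ _)   (inj₂ y≡b) (inj₂ z≡b) _   y≢z = ⊥-elim (y≢z (trans y≡b (sym z≡b)))
  ≡-of-two-values (inj₂ _)   (inj₁ y≡a) (inj₁ z≡a) _   y≢z = ⊥-elim (y≢z (trans y≡a (sym z≡a)))
  ≡-of-two-values (inj₂ x≡b) (inj₁ _)   (inj₂ z≡b) x≢z _   = ⊥-elim (x≢z (trans x≡b (sym z≡b)))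

  unique-twoValues : a ≢ b → ∀ {e} → Unique e → a ∈ e → b ∈ e →
                     (∀ {x} → x ∈ e → x ≡ a ⊎ x ≡ b) → e ≡ a ∷ b ∷ [] ⊎ e ≡ b ∷ a ∷ []
  unique-twoValues a≢b {x ∷ []} _ a∈e b∈e _ =
    ⊥-elim (a≢b (trans (singleton⁻ a∈e) (sym (singleton⁻ b∈e))))
  unique-twoValues a≢b {x ∷ y ∷ []} ((x≢y ∷ []) ∷ _) _ _ twoValued
    with twoValued (here refl) | twoValued (there (here refl))
  ... | inj₁ x≡a | y∈ab = inj₁ (cong₂ (λ x y → x ∷ y ∷ []) x≡a (other-value x≡a y∈ab x≢y))
  ... | inj₂ x≡b | y∈ab = inj₂ (cong₂ (λ x y → x ∷ y ∷ []) x≡b (other-value x≡b (Sum.swap y∈ab) x≢y))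
  unique-twoValues a≢b {x ∷ y ∷ z ∷ _} ((x≢y ∷ x≢z ∷ _) ∷ (y≢z ∷ _) ∷ _) _ _ twoValued =
    ⊥-elim (x≢y (≡-of-two-values (twoValued (here refl)) (twoValued (there (here refl)))
                                 (twoValued (there (there (here refl)))) x≢z y≢z))

module _ {G H : Graph} (h : Graph.V G → Graph.V H)
         (h-edge : ∀ u v → Graph.E G u v → Graph.E H (h u) (h v)) where

  Reach-map : {S : Graph.V G → Set} {T : Graph.V H → Set} → (∀ {v} → S v → T (h v)) →
              ∀ {u v} → Reach G S u v → Reach H T (h u) (h v)
  Reach-map S⇒T (here s)     = here (S⇒T s)
  Reach-map S⇒T (step r e s) = step (Reach-map S⇒T r) (Sum.map (h-edge _ _) (h-edge _ _) e) (S⇒T s)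

Proper : (G : Graph) {A : Set} → (Graph.V G → A) → Set
Proper G f = ∀ u v → Graph.E G u v → f u ≢ f v

module _ {G : Graph} where
  open Graph G

  Reach-mono : {S T : V → Set} → (∀ {v} → S v → T v) → ∀ {u v} → Reach G S u v → Reach G T u v
  Reach-mono = Reach-map (λ v → v) (λ _ _ e → e)

  Reach-target : ∀ {S u v} → Reach G S u v → S v
  Reach-target (here s)     = s
  Reach-target (step _ _ s) = s

  Reach-trans : ∀ {S u w v} → Reach G S u w → Reach G S w v → Reach G S u v
  Reach-trans r (here _)      = r
  Reach-trans r (step r′ e s) = step (Reach-trans r r′) e s

  Reach-sym : ∀ {S u v} → Reach G S u v → Reach G S v u
  Reach-sym (here s)     = here s
  Reach-sym (step r e s) = Reach-trans (step (here s) (Sum.swap e) (Reach-target r)) (Reach-sym r)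

  reachableFromRoot⇒connected : ∀ r → (∀ v → Reach G (λ _ → ⊤) r v) → Connected G
  reachableFromRoot⇒connected r from-r u v = Reach-trans (Reach-sym (from-r u)) (from-r v)

  proper-adjacent : ∀ {A : Set} {f : V → A} {u v} → Proper G f → E u v ⊎ E v u → f u ≢ f v
  proper-adjacent proper (inj₁ e) = proper _ _ e
  proper-adjacent proper (inj₂ e) = proper _ _ e ∘ sym

  sameValue-across-edge : ∀ {A B : Set} {f : V → A} {g : V → B} {u w v} →
                          Proper G f → Proper G g → AtMostTwoValues g →
                          (g u ≡ g w → f u ≡ f w) → E w v ⊎ E v w → f u ≡ f v → g u ≡ g v
  sameValue-across-edge pf pg two-g g⇒f e fu≡fv =
    two-g (λ gu≡gw → proper-adjacent pf e (trans (sym (g⇒f gu≡gw)) fu≡fv))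
          (proper-adjacent pg e ∘ sym)

  Reach⇒sameValue⇔ : ∀ {A B : Set} {f : V → A} {g : V → B} {S u v} →
                      Proper G f → Proper G g → AtMostTwoValues f → AtMostTwoValues g →
                      Reach G S u v → (f u ≡ f v ⇔ g u ≡ g v)
  Reach⇒sameValue⇔ _ _ _ _ (here _) = mk⇔ (λ _ → refl) (λ _ → refl)
  Reach⇒sameValue⇔ {f = f} {g} {u = u} pf pg two-f two-g (step {w = w} r e _) =
    mk⇔ (sameValue-across-edge pf pg two-g (Equivalence.from ih) e)
        (sameValue-across-edge pg pf two-f (Equivalence.to ih) e)
    where
    ih : f u ≡ f w ⇔ g u ≡ g w
    ih = Reach⇒sameValue⇔ pf pg two-f two-g r

module _ {G : Graph} {ℓ : ℕ} {c : Graph.V G → Fin ℓ} where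
  open Graph G

  monochromatic-Reach⇒≡ : ∀ {S x} → Valid G c → (∀ {v} → S v → c v ≡ x) →
                          ∀ {u v} → Reach G S u v → u ≡ v
  monochromatic-Reach⇒≡ valid S⇒x (here _) = refl
  monochromatic-Reach⇒≡ valid S⇒x (step r e s) =
    ⊥-elim (proper-adjacent valid e (trans (S⇒x (Reach-target r)) (sym (S⇒x s))))

  monochromatic-components : ∀ {x n} → Valid G c → ColourClass c x ↔ Fin n →
                             HasComponents G (λ v → c v ∈ [ x ]) n
  monochromatic-components {x} {n} valid class↔ =
    component , surjective , λ u v su sv → sound u v su sv , complete su sv
    where
    open Inverse class↔
    component : ∀ v → c v ∈ [ x ] → Fin n
    component v s = to (v , singleton⁻ s)
    surjective : ∀ j → ∃ λ v → Σ (c v ∈ [ x ]) λ s → component v s ≡ j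
    surjective j = proj₁ (from j) , here (proj₂ (from j)) , strictlyInverseˡ j
    sound : ∀ u v su sv → component u su ≡ component v sv → Reach G (λ w → c w ∈ [ x ]) u v
    sound u v su sv eq = subst (Reach G _ u) (cong proj₁ (Injection.injective (↔⇒↣ class↔) eq)) (here su)
    complete : ∀ {u v} su sv → Reach G (λ w → c w ∈ [ x ]) u v → component u su ≡ component v sv
    complete su sv r with monochromatic-Reach⇒≡ valid singleton⁻ r
    ... | refl = cong to (Σ-≡-irrelevant refl)

  connected-oneComponent : ∀ {S} → Connected G → (∀ v → S v) → V → HasComponents G S 1
  connected-oneComponent conn total v =
    (λ _ _ → zero) , (λ { zero → v , total v , refl }) ,
    λ u w _ _ → (λ _ → Reach-mono (λ _ → total _) (conn u w)) , (λ _ → refl)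

  ExactlyTwoColours-sym : ∀ {a b} → ExactlyTwoColours G c a b → ExactlyTwoColours G c b a
  ExactlyTwoColours-sym (a≢b , covered , has-a , has-b) = a≢b ∘ sym , Sum.swap ∘ covered , has-b , has-a

  exactlyTwoColours⇒atMostTwoValues : ∀ {a b} → ExactlyTwoColours G c a b → AtMostTwoValues c
  exactlyTwoColours⇒atMostTwoValues (_ , covered , _) = ≡-of-two-values (covered _) (covered _) (covered _)

  markingSequence-exactlyTwoColours : ∀ {a b} → ExactlyTwoColours G c a b → ∀ {e} → MarkingSequence G c e →
                                      e ≡ a ∷ b ∷ [] ⊎ e ≡ b ∷ a ∷ []
  markingSequence-exactlyTwoColours {a} {b} (a≢b , covered , has-a , has-b) {e} (unique , enumerates) =
    unique-twoValues a≢b unique (proj₂ (enumerates a) has-a) (proj₂ (enumerates b) has-b) used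
    where
    used : ∀ {x} → x ∈ e → x ≡ a ⊎ x ≡ b
    used {x} x∈e with proj₁ (enumerates x) x∈e
    ... | v , refl = covered v

  module _ {a b : Fin ℓ} (ex : ExactlyTwoColours G c a b) where
    private
      covered : ∀ v → c v ∈ a ∷ b ∷ []
      covered v = Sum.[ here , there ∘ here ]′ (proj₁ (proj₂ ex) v)

    pair-markingSequence : MarkingSequence G c (a ∷ b ∷ [])
    pair-markingSequence = ((proj₁ ex ∷ []) ∷ [] ∷ []) , λ x →
      (λ { (here refl) → proj₁ (proj₂ (proj₂ ex)) ; (there (here refl)) → proj₂ (proj₂ (proj₂ ex)) }) ,
      λ { (v , refl) → covered v }

    pair-locSeq : ∀ {n} → Connected G → Valid G c → ColourClass c a ↔ Fin n →
                  LocSeq G c (a ∷ b ∷ []) n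
    pair-locSeq {n} conn valid class↔ = (1 , ≤-refl , s≤s z≤n , firstLayer) , bounded
      where
      has-a : ColourClass c a
      has-a = proj₁ (proj₂ (proj₂ ex))
      firstLayer : HasComponents G (λ v → c v ∈ [ a ]) n
      firstLayer = monochromatic-components valid class↔
      bounded : ∀ i → 1 ≤ i → i ≤ 2 → ∃ λ g → HasComponents G (Layer G c (a ∷ b ∷ []) i) g × g ≤ n
      bounded 1 _ _ = n , firstLayer , ≤-refl
      bounded 2 _ _ = 1 , connected-oneComponent conn covered (proj₁ has-a) ,
                      ≤-<-trans z≤n (toℕ<n (Inverse.to class↔ has-a))
      bounded (suc (suc (suc _))) _ (s≤s (s≤s ()))

  twoColouring-strictlyLocal : ∀ {a b m n} → Connected G → Valid G c → ExactlyTwoColours G c a b →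
                               ColourClass c a ↔ Fin m → ColourClass c b ↔ Fin n →
                               StrictlyLocal G c (m ⊓ n)
  twoColouring-strictlyLocal {a} {b} {m} {n} conn valid ex a↔ b↔ = optimal , lowerBound
    where
    ex′ : ExactlyTwoColours G c b a
    ex′ = ExactlyTwoColours-sym ex
    optimal : ∃ λ e → MarkingSequence G c e × LocSeq G c e (m ⊓ n)
    optimal with m ≤? n
    ... | yes m≤n = _ , pair-markingSequence ex ,
                    subst (LocSeq G c _) (sym (m≤n⇒m⊓n≡m m≤n)) (pair-locSeq ex conn valid a↔)
    ... | no m≰n  = _ , pair-markingSequence ex′ ,
                    subst (LocSeq G c _) (sym (m≥n⇒m⊓n≡n (≰⇒≥ m≰n))) (pair-locSeq ex′ conn valid b↔)
    lowerBound : ∀ e → MarkingSequence G c e → ∃ λ k → LocSeq G c e k × m ⊓ n ≤ k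
    lowerBound e ms with markingSequence-exactlyTwoColours ex ms
    ... | inj₁ refl = m , pair-locSeq ex conn valid a↔ , m⊓n≤m m n
    ... | inj₂ refl = n , pair-locSeq ex′ conn valid b↔ , m⊓n≤n m n

  bipartite-colourClass↔side : ∀ {a b} (side : V → Bool) → Connected G → Valid G c →
                               ExactlyTwoColours G c a b → Proper G side →
                               ∃ λ t → ColourClass c a ↔ Σ V (λ v → side v ≡ t)
  bipartite-colourClass↔side {a} side conn valid ex@(_ , _ , (r , cr≡a) , _) proper =
    side r , Σ-≡-cong sameSide
    where
    sameSide : ∀ v → c v ≡ a ⇔ side v ≡ side r
    sameSide v = mk⇔ (λ cv≡a → Equivalence.to sameValue (trans cv≡a (sym cr≡a)))
                     (λ sv≡sr → trans (Equivalence.from sameValue sv≡sr) cr≡a)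
      where
      sameValue : c v ≡ c r ⇔ side v ≡ side r
      sameValue = Reach⇒sameValue⇔ valid proper (exactlyTwoColours⇒atMostTwoValues ex)
                                   (bool-atMostTwoValues side) (conn v r)

  bipartite-strictlyLocal : ∀ {a b n} (side : V → Bool) → Connected G → Valid G c →
                            ExactlyTwoColours G c a b → Proper G side →
                            (∀ t → Σ V (λ v → side v ≡ t) ↔ Fin n) → StrictlyLocal G c n
  bipartite-strictlyLocal {n = n} side conn valid ex proper sides =
    subst (StrictlyLocal G c) (⊓-idem n)
          (twoColouring-strictlyLocal conn valid ex (classSize ex) (classSize (ExactlyTwoColours-sym ex)))
    where
    classSize : ∀ {x y} → ExactlyTwoColours G c x y → ColourClass c x ↔ Fin n
    classSize ex′ with bipartite-colourClass↔side side conn valid ex′ proper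
    ... | t , class↔side = ↔-trans class↔side (sides t)

index-∈-lookup : {A : Set} (xs : List A) (i : Fin (length xs)) → index (∈-lookup {xs = xs} i) ≡ i
index-∈-lookup (_ ∷ _)  zero    = refl
index-∈-lookup (_ ∷ xs) (suc i) = cong suc (index-∈-lookup xs i)

colourClass↔countColour : {V : Set} {vs : List V} → Unique vs → (∀ v → v ∈ vs) →
                          ∀ {ℓ} (c : V → Fin ℓ) x → ColourClass c x ↔ Fin (countColour vs c x)
colourClass↔countColour {vs = vs} unique complete c x = mk↔ₛ′ to from to∘from from∘to
  where
  P? : Decidable (λ v → c v ≡ x)
  P? v = c v ≟ x
  to : ColourClass c x → Fin (countColour vs c x)
  to (v , p) = index (∈-filter⁺ P? (complete v) p)
  from : Fin (countColour vs c x) → ColourClass c x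
  from j = lookup (filter P? vs) j , proj₂ (∈-filter⁻ P? {xs = vs} (∈-lookup j))
  to∘from : ∀ j → to (from j) ≡ j
  to∘from j = trans (cong index (unique⇒irrelevant (Unique.filter⁺ P? unique) _ _)) (index-∈-lookup (filter P? vs) j)
  from∘to : ∀ s → from (to s) ≡ s
  from∘to (v , p) = Σ-≡-irrelevant (sym (lookup-index (∈-filter⁺ P? (complete v) p)))

parity : ∀ {d} → Vec Bool d → Bool
parity []       = false
parity (x ∷ xs) = x xor parity xs

hamming-refl : ∀ {d} (v : Vec Bool d) → hamming v v ≡ 0
hamming-refl []          = refl
hamming-refl (false ∷ v) = hamming-refl v
hamming-refl (true ∷ v)  = hamming-refl v

hamming≡0⇒≡ : ∀ {d} (u v : Vec Bool d) → hamming u v ≡ 0 → u ≡ v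
hamming≡0⇒≡ []          []          _ = refl
hamming≡0⇒≡ (false ∷ u) (false ∷ v) h = cong (false ∷_) (hamming≡0⇒≡ u v h)
hamming≡0⇒≡ (true ∷ u)  (true ∷ v)  h = cong (true ∷_) (hamming≡0⇒≡ u v h)

parity-proper : ∀ d → Proper (Q d) parity
parity-proper _ []          []          ()
parity-proper _ (false ∷ u) (false ∷ v) h = parity-proper _ u v h
parity-proper _ (true ∷ u)  (true ∷ v)  h = parity-proper _ u v h ∘ not-injective
parity-proper _ (false ∷ u) (true ∷ v)  h = not-¬ (cong parity (hamming≡0⇒≡ u v (suc-injective h)))
parity-proper _ (true ∷ u)  (false ∷ v) h = not-¬ (cong parity (sym (hamming≡0⇒≡ u v (suc-injective h)))) ∘ sym

∷-edge : ∀ {d} x (u v : Vec Bool d) → hamming u v ≡ 1 → hamming (x ∷ u) (x ∷ v) ≡ 1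
∷-edge false _ _ h = h
∷-edge true  _ _ h = h

Q-connected : ∀ d → Connected (Q d)
Q-connected zero    []      []      = here tt
Q-connected (suc d) (x ∷ u) (y ∷ v) =
  Reach-trans (Reach-map (x ∷_) (∷-edge x) (λ _ → tt) (Q-connected d u v)) (flipHead x y)
  where
  flipHead : ∀ x y → Reach (Q (suc d)) (λ _ → ⊤) (x ∷ v) (y ∷ v)
  flipHead false false = here tt
  flipHead true  true  = here tt
  flipHead false true  = step (here tt) (inj₁ (cong suc (hamming-refl v))) tt
  flipHead true  false = step (here tt) (inj₁ (cong suc (hamming-refl v))) tt

xor-cancelʳ : ∀ x y → (x xor y) xor y ≡ x
xor-cancelʳ x y = begin
  (x xor y) xor y  ≡⟨ xor-assoc x y y ⟩
  x xor (y xor y)  ≡⟨ cong (x xor_) (xor-same y) ⟩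
  x xor false      ≡⟨ xor-identityʳ x ⟩
  x                ∎
  where open ≡-Reasoning

parityClass↔Vec : ∀ n t → Σ (Vec Bool (suc n)) (λ v → parity v ≡ t) ↔ Vec Bool n
parityClass↔Vec n t = mk↔ₛ′ to from (λ _ → refl) from∘to
  where
  to : Σ (Vec Bool (suc n)) (λ v → parity v ≡ t) → Vec Bool n
  to ((_ ∷ w) , _) = w
  from : Vec Bool n → Σ (Vec Bool (suc n)) (λ v → parity v ≡ t)
  from w = ((t xor parity w) ∷ w) , xor-cancelʳ t (parity w)
  from∘to : ∀ s → from (to s) ≡ s
  from∘to ((x ∷ w) , x+w≡t) =
    Σ-≡-irrelevant (cong (_∷ w) (trans (cong (_xor parity w) (sym x+w≡t)) (xor-cancelʳ x (parity w))))

Vec-Bool↔Fin-2^ : ∀ n → Vec Bool n ↔ Fin (2 ^ n)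
Vec-Bool↔Fin-2^ n = ↔-sym (↔-trans (Fin[m^n]↔Fin[m]^n 2 n) (↔-trans (lift↔ n 2↔Bool) (↔Vec n)))

hypercube-strictlyLocal : ∀ d {ℓ} (c : Vec Bool d → Fin ℓ) {a b} → Valid (Q d) c →
                          ExactlyTwoColours (Q d) c a b → StrictlyLocal (Q d) c (2 ^ (d ∸ 1))
hypercube-strictlyLocal zero    c valid (a≢b , _ , ([] , refl) , ([] , c[]≡b)) = ⊥-elim (a≢b c[]≡b)
hypercube-strictlyLocal (suc n) c valid ex =
  bipartite-strictlyLocal parity (Q-connected (suc n)) valid ex (parity-proper (suc n))
    (λ t → ↔-trans (parityClass↔Vec n t) (Vec-Bool↔Fin-2^ n))

knightVertices-unique : ∀ d₁ d₂ → Unique (knightVertices d₁ d₂)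
knightVertices-unique d₁ d₂ = Unique.cartesianProduct⁺ (Unique.allFin⁺ d₁) (Unique.allFin⁺ d₂)

knightVertices-complete : ∀ d₁ d₂ (v : KnightV d₁ d₂) → v ∈ knightVertices d₁ d₂
knightVertices-complete _ _ (r , s) = ∈-cartesianProduct⁺ (∈-allFin r) (∈-allFin s)

gear-connected : ∀ d → Connected (Gear d)
gear-connected d = reachableFromRoot⇒connected hub fromHub
  where
  fromHub : ∀ v → Reach (Gear d) (λ _ → ⊤) hub v
  fromHub hub     = here tt
  fromHub (rim i) = step (here tt) (inj₁ (hub-rim i)) tt
  fromHub (mid i) = step (fromHub (rim i)) (inj₁ (rim-mid i)) tt

module _ {m : ℕ} where

  rim-injective : ∀ {i j : Fin m} → rim {m} i ≡ rim j → i ≡ j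
  rim-injective refl = refl

  mid-injective : ∀ {i j : Fin m} → mid {m} i ≡ mid j → i ≡ j
  mid-injective refl = refl

  rims-mids-disjoint : ∀ {v : GearV m} → v ∈ map rim (allFin m) → v ∉ map mid (allFin m)
  rims-mids-disjoint v∈rims v∈mids with ∈-map⁻ rim v∈rims | ∈-map⁻ mid v∈mids
  ... | _ , _ , refl | _ , _ , ()

gearVertices-unique : ∀ d → Unique (gearVertices d)
gearVertices-unique d =
  All.++⁺ (All.map⁺ {f = rim} (All.universal (λ _ ()) (allFin _)))
          (All.map⁺ {f = mid} (All.universal (λ _ ()) (allFin _))) ∷
  Unique.++⁺ (Unique.map⁺ rim-injective (Unique.allFin⁺ _)) (Unique.map⁺ mid-injective (Unique.allFin⁺ _))
             (λ (v∈rims , v∈mids) → rims-mids-disjoint v∈rims v∈mids)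

gearVertices-complete : ∀ d (v : GearV (d ∸ 1)) → v ∈ gearVertices d
gearVertices-complete _ hub     = here refl
gearVertices-complete _ (rim i) = there (∈-++⁺ˡ (∈-map⁺ rim (∈-allFin i)))
gearVertices-complete _ (mid i) = there (∈-++⁺ʳ _ (∈-map⁺ mid (∈-allFin i)))

distinct-from-both : ∀ {k} (i j : Fin (3 + k)) → ∃ λ x → i ≢ x × j ≢ x
distinct-from-both {k} i j with i ≟ j
... | yes refl = punchIn i zero , punchInᵢ≢i i zero ∘ sym , punchInᵢ≢i i zero ∘ sym
... | no i≢j   = punchIn i y , punchInᵢ≢i i y ∘ sym , j≢punchIn-i-y
  where
  j′ y : Fin (2 + k)
  j′ = punchOut i≢j
  y  = punchIn j′ zero
  j≢punchIn-i-y : j ≢ punchIn i y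
  j≢punchIn-i-y j≡ = punchInᵢ≢i j′ zero (sym (punchIn-injective i j′ y (trans (punchIn-punchOut i≢j) j≡)))

crown-connected : ∀ d → 3 ≤ d → Connected (Crown d)
crown-connected (suc (suc (suc k))) (s≤s (s≤s (s≤s z≤n))) = reachableFromRoot⇒connected (false , zero) fromRoot
  where
  toX : ∀ i → Reach (Crown (3 + k)) (λ _ → ⊤) (false , zero) (false , i)
  toX i with distinct-from-both i zero
  ... | x , i≢x , 0≢x = step (step (here tt) (inj₁ (xy zero x 0≢x)) tt) (inj₁ (yx i x i≢x)) tt
  fromRoot : ∀ v → Reach (Crown (3 + k)) (λ _ → ⊤) (false , zero) v
  fromRoot (false , i) = toX i
  fromRoot (true , j) with distinct-from-both j j
  ... | x , j≢x , _ = step (toX x) (inj₁ (xy x j (j≢x ∘ sym))) tt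

crown-side-proper : ∀ d → Proper (Crown d) proj₁
crown-side-proper _ _ _ (xy _ _ _) ()
crown-side-proper _ _ _ (yx _ _ _) ()

crown-side↔Fin : ∀ d t → Σ (Bool × Fin d) (λ v → proj₁ v ≡ t) ↔ Fin d
crown-side↔Fin d t = mk↔ₛ′ (λ s → proj₂ (proj₁ s)) (λ i → (t , i) , refl) (λ _ → refl) from∘to
  where
  from∘to : ∀ (s : Σ (Bool × Fin d) (λ v → proj₁ v ≡ t)) → ((t , proj₂ (proj₁ s)) , refl) ≡ s
  from∘to ((_ , i) , refl) = refl

corollary17 :
    (∀ (d ℓ : ℕ) (c : Graph.V (Q d) → Fin ℓ) (a b : Fin ℓ) →
       Valid (Q d) c → ExactlyTwoColours (Q d) c a b →
       StrictlyLocal (Q d) c (2 ^ (d ∸ 1)))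
    ×
    (∀ (d₁ d₂ ℓ : ℕ) (c : KnightV d₁ d₂ → Fin ℓ) (a b : Fin ℓ) →
       Connected (Knight d₁ d₂) →
       Valid (Knight d₁ d₂) c → ExactlyTwoColours (Knight d₁ d₂) c a b →
       StrictlyLocal (Knight d₁ d₂) c
         (countColour (knightVertices d₁ d₂) c a ⊓ countColour (knightVertices d₁ d₂) c b))
    ×
    (∀ (d ℓ : ℕ) (c : Graph.V (Gear d) → Fin ℓ) (a b : Fin ℓ) →
       4 ≤ d →
       Valid (Gear d) c → ExactlyTwoColours (Gear d) c a b →
       StrictlyLocal (Gear d) c
         (countColour (gearVertices d) c a ⊓ countColour (gearVertices d) c b))
    ×
    (∀ (d ℓ : ℕ) (c : Graph.V (Crown d) → Fin ℓ) (a b : Fin ℓ) →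
       3 ≤ d →
       Valid (Crown d) c → ExactlyTwoColours (Crown d) c a b →
       StrictlyLocal (Crown d) c d)
corollary17 =
    (λ d _ c _ _ → hypercube-strictlyLocal d c)
  , (λ d₁ d₂ _ c a b conn valid ex →
       let classSize = colourClass↔countColour (knightVertices-unique d₁ d₂) (knightVertices-complete d₁ d₂) c
       in twoColouring-strictlyLocal conn valid ex (classSize a) (classSize b))
    -- The hub makes every gear graph connected.
  , (λ d _ c a b _ valid ex →
       let classSize = colourClass↔countColour (gearVertices-unique d) (gearVertices-complete d) c
       in twoColouring-strictlyLocal (gear-connected d) valid ex (classSize a) (classSize b))
  , (λ d _ c _ _ 3≤d valid ex →
       bipartite-strictlyLocal proj₁ (crown-connected d 3≤d) valid ex (crown-side-proper d) (crown-side↔Fin d))
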